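{- Let $T=(\mathcal M,\mathcal E)$ be a clique tree of a chordal claw-free graph $G=(V,E)$. Then for all distinct vertices $v,w\in V$, the graph $T[\mathcal M_v\setminus\mathcal M_w]$ is connected (where the empty graph counts as connected).
   Context: Graphs are finite simple undirected. A graph is chordal if every cycle of length at least 4 has a chord, and claw-free if it has no induced $K_{1,3}$. A max clique is an inclusion-maximal clique; $\mathcal M$ is the set of max cliques of $G$ and $\mathcal M_v$ the set of max cliques containing $v$. A clique tree of a chordal graph $G$ is a tree $T=(\mathcal M,\mathcal E)$ on $\mathcal M$ such that $T[\mathcal M_v]$ is connected for every vertex $v$. -}

module Defs where

open import Data.Nat using (ℕ; zero; suc; _≤_)
open import Data.Fin using (Fin; toℕ)
open import Data.Fin.Subset using (Subset; _∈_; _∉_; _⊆_)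
open import Data.Product using (Σ; ∃; ∃-syntax; _×_; _,_)
open import Data.Sum using (_⊎_)
open import Data.Unit using (⊤)
open import Data.Empty using (⊥)
open import Relation.Nullary using (¬_; Dec)
open import Relation.Binary.PropositionalEquality using (_≡_; _≢_)
open import Function.Definitions using (Injective)

record Graph (n : ℕ) : Set₁ where
  field
    Adj     : Fin n → Fin n → Set
    Adj?    : ∀ x y → Dec (Adj x y)
    Adj-sym : ∀ {x y} → Adj x y → Adj y x
    Adj-irr : ∀ {x} → ¬ Adj x x
open Graph public

data WalkIn {n : ℕ} (G : Graph n) (S : Fin n → Set) : Fin n → Fin n → Set where
  here : ∀ {x} → S x → WalkIn G S x x
  step : ∀ {x y z} → S x → Adj G x y → WalkIn G S y z → WalkIn G S x z

InducedConnected : {n : ℕ} → Graph n → (Fin n → Set) → Set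
InducedConnected G S = ∀ x y → S x → S y → WalkIn G S x y

Connected : {n : ℕ} → Graph n → Set
Connected G = InducedConnected G (λ _ → ⊤)

CycNext : (k : ℕ) → {k' : ℕ} → Fin k' → Fin k' → Set
CycNext k i j = (toℕ j ≡ suc (toℕ i)) ⊎ ((suc (toℕ i) ≡ k) × (toℕ j ≡ 0))

record Cycle {n : ℕ} (G : Graph n) (k : ℕ) : Set where
  field
    vtx     : Fin k → Fin n
    vtx-inj : Injective _≡_ _≡_ vtx
    vtx-adj : ∀ i j → CycNext k i j → Adj G (vtx i) (vtx j)
open Cycle public

HasChord : {n : ℕ} {G : Graph n} {k : ℕ} → Cycle G k → Set
HasChord {G = G} {k} C =
  ∃[ i ] ∃[ j ] (Adj G (vtx C i) (vtx C j) × ¬ CycNext k i j × ¬ CycNext k j i)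

Chordal : {n : ℕ} → Graph n → Set
Chordal G = ∀ k → 4 ≤ k → (C : Cycle G k) → HasChord C

ClawFree : {n : ℕ} → Graph n → Set
ClawFree G = ∀ c a₁ a₂ a₃ →
  Adj G c a₁ → Adj G c a₂ → Adj G c a₃ →
  a₁ ≢ a₂ → a₁ ≢ a₃ → a₂ ≢ a₃ →
  ¬ Adj G a₁ a₂ → ¬ Adj G a₁ a₃ → ¬ Adj G a₂ a₃ → ⊥

IsClique : {n : ℕ} → Graph n → Subset n → Set
IsClique G S = ∀ x y → x ∈ S → y ∈ S → x ≢ y → Adj G x y

IsMaxClique : {n : ℕ} → Graph n → Subset n → Set
IsMaxClique G S = IsClique G S × (∀ S' → IsClique G S' → S ⊆ S' → S' ⊆ S)

Acyclic : {n : ℕ} → Graph n → Set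
Acyclic G = ∀ k → 3 ≤ k → ¬ Cycle G k

IsTree : {n : ℕ} → Graph n → Set
IsTree G = Connected G × Acyclic G

record CliqueTree {n : ℕ} (G : Graph n) : Set₁ where
  field
    m       : ℕ
    K       : Fin m → Subset n
    K-max   : ∀ i → IsMaxClique G (K i)
    K-inj   : Injective _≡_ _≡_ K
    K-surj  : ∀ S → IsMaxClique G S → ∃[ i ] (K i ≡ S)
    T       : Graph m
    T-tree  : IsTree T
    T-conn  : ∀ v → InducedConnected T (λ i → v ∈ K i)
open CliqueTree public

module Submission where

-- Let v ≢ w, and let x, y be nodes of the clique tree T with v ∈ K x, K y and
-- w ∉ K x, K y.  If v and w are not adjacent, no max clique contains both, so
-- T[M_v ∖ M_w] = T[M_v], which is connected by the clique-tree property.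
-- If v and w are adjacent we proceed in two steps.
--   (1) T contains an x–y walk avoiding M_w.  By maximality K x contains some
--       a not adjacent to w and K y some b not adjacent to w.  If a = b, use
--       T[M_a].  Otherwise claw-freeness at v (adjacent to a, b, w) forces
--       a ~ b; the edge ab lies in a max clique D, and T[M_a], T[M_b] join x
--       to D to y.  Every clique meeting a or b misses w.
--   (2) Take an x–y path P in T[M_v].  In a tree every node of a path between
--       x and y is met by every x–y walk; by (1) no node of P lies in M_w, so
--       P is already a walk in T[M_v ∖ M_w].

open import Defs
open import Data.Nat using (ℕ; zero; suc; pred; _≤_; _<_; _+_; s≤s; z≤n)
open import Data.Nat.Properties using (<-irrefl; <-≤-trans; ≤-<-trans; +-identityʳ; +-suc; +-monoˡ-≤; m≤n+m; module ≤-Reasoning)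
open import Data.Fin using (Fin; toℕ; zero; suc; _≟_)
open import Data.Fin.Subset using (Subset; _∈_; _∉_; _⊆_; _∪_; ⁅_⁆; ∣_∣)
open import Data.Fin.Subset.Properties using (_∈?_; x∈p∪q⁻; p⊆p∪q; q⊆p∪q; x∈⁅x⁆; x∈⁅y⁆⇒x≡y; p⊂q⇒∣p∣<∣q∣; ∣p∣≤n)
open import Data.Fin.Properties using (any?; all?; ¬∀⟶∃¬)
open import Data.List using (List; []; _∷_; length; lookup)
open import Data.List.Relation.Unary.All as All using (All; []; _∷_)
open import Data.List.Relation.Unary.All.Properties using (¬Any⇒All¬)
open import Data.List.Relation.Unary.Any using (here; there)
open import Data.List.Relation.Unary.AllPairs using ([]; _∷_)
open import Data.List.Relation.Unary.Unique.Propositional using (Unique)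
open import Data.List.Membership.Propositional using () renaming (_∈_ to _∈L_)
open import Data.List.Membership.Propositional.Properties using (∈-lookup)
import Data.List.Membership.DecPropositional as DecMembership
open import Data.Product using (Σ; ∃; _×_; _,_; proj₁; proj₂)
open import Data.Sum using (inj₁; inj₂)
open import Data.Empty using (⊥; ⊥-elim)
open import Relation.Nullary using (¬_; Dec; yes; no)
open import Relation.Nullary.Decidable using (_×-dec_; _→-dec_; ¬?)
open import Relation.Binary.PropositionalEquality using (_≡_; _≢_; refl; sym; cong; subst)

lookup-injective : {A : Set} (xs : List A) → Unique xs →
                   ∀ i j → lookup xs i ≡ lookup xs j → i ≡ j
lookup-injective (x ∷ xs) (_ ∷ _) zero zero _ = refl
lookup-injective (x ∷ xs) (x∉xs ∷ _) zero (suc j) x≡xs[j] =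
  ⊥-elim (All.lookup x∉xs (∈-lookup j) x≡xs[j])
lookup-injective (x ∷ xs) (x∉xs ∷ _) (suc i) zero xs[i]≡x =
  ⊥-elim (All.lookup x∉xs (∈-lookup i) (sym xs[i]≡x))
lookup-injective (x ∷ xs) (_ ∷ u) (suc i) (suc j) e =
  cong suc (lookup-injective xs u i j e)

module WalkFacts {n : ℕ} (G : Graph n) where

  open DecMembership (_≟_ {n}) using () renaming (_∈?_ to _∈L?_)

  later : ∀ {S x y} → WalkIn G S x y → List (Fin n)
  later (here _) = []
  later (step {y = y} _ _ r) = y ∷ later r

  verts : ∀ {S x y} → WalkIn G S x y → List (Fin n)
  verts {x = x} W = x ∷ later W

  IsPath : ∀ {S x y} → WalkIn G S x y → Set
  IsPath W = Unique (verts W)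

  vertsIn : ∀ {S x y} (W : WalkIn G S x y) → All S (verts W)
  vertsIn (here s) = s ∷ []
  vertsIn (step s _ r) = s ∷ vertsIn r

  startIn : ∀ {S x y} → WalkIn G S x y → S x
  startIn W = All.head (vertsIn W)

  endIn : ∀ {S x y} → WalkIn G S x y → S y
  endIn (here s) = s
  endIn (step _ _ r) = endIn r

  restrict : ∀ {S S' x y} (W : WalkIn G S x y) → All S' (verts W) → WalkIn G S' x y
  restrict (here _) (s ∷ []) = here s
  restrict (step _ a r) (s ∷ ss) = step s a (restrict r ss)

  weaken : ∀ {S S' x y} → (∀ {z} → S z → S' z) → WalkIn G S x y → WalkIn G S' x y
  weaken f (here s) = here (f s)
  weaken f (step s a r) = step (f s) a (weaken f r)

  _++W_ : ∀ {S x y z} → WalkIn G S x y → WalkIn G S y z → WalkIn G S x z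
  here _ ++W W = W
  step s a r ++W W = step s a (r ++W W)

  reverse : ∀ {S x y} → WalkIn G S x y → WalkIn G S y x
  reverse (here s) = here s
  reverse (step s a r) = reverse r ++W step (startIn r) (Adj-sym G a) (here s)

  suffixFrom : ∀ {S x y z} (W : WalkIn G S y z) → IsPath W → x ∈L verts W →
               Σ (WalkIn G S x z) IsPath
  suffixFrom W p (here refl) = W , p
  suffixFrom (step _ _ r) (_ ∷ p) (there x∈r) = suffixFrom r p x∈r

  toPath : ∀ {S x y} → WalkIn G S x y → Σ (WalkIn G S x y) IsPath
  toPath (here s) = here s , ([] ∷ [])
  toPath {x = x} (step s a r) with toPath r
  ... | R , pR with x ∈L? verts R
  ...   | yes x∈R = suffixFrom R pR x∈R
  ...   | no x∉R = step s a R , (¬Any⇒All¬ (verts R) x∉R ∷ pR)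

  lookup-last : ∀ {S x y} (W : WalkIn G S x y) (i : Fin (length (verts W))) →
                suc (toℕ i) ≡ length (verts W) → lookup (verts W) i ≡ y
  lookup-last (here _) zero _ = refl
  lookup-last (step _ _ (here _)) zero ()
  lookup-last (step _ _ (step _ _ _)) zero ()
  lookup-last (step _ _ r) (suc i) e = lookup-last r i (cong pred e)

  lookup-next : ∀ {S x y} (W : WalkIn G S x y) (i j : Fin (length (verts W))) →
                toℕ j ≡ suc (toℕ i) → Adj G (lookup (verts W) i) (lookup (verts W) j)
  lookup-next (step _ a _) zero (suc zero) _ = a
  lookup-next (step _ _ r) (suc i) (suc j) e = lookup-next r i j (cong pred e)
  lookup-next (here _) zero zero ()
  lookup-next (step _ _ _) zero zero ()
  lookup-next (step _ _ _) zero (suc (suc _)) ()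
  lookup-next (step _ _ _) (suc _) zero ()

  -- A vertex C adjacent to both ends p ≢ s of a walk avoiding C closes a cycle
  -- of length at least 3, impossible in an acyclic graph.
  noCycleThrough : Acyclic G → ∀ {C p s} → p ≢ s → Adj G C p → Adj G s C →
                   ¬ WalkIn G (C ≢_) p s
  noCycleThrough acyc {C} {p} {s} p≢s Cp sC W₀ with toPath W₀
  ... | W , pW = acyc (length L) (threeVertices W) cycle
    where
    L : List (Fin n)
    L = C ∷ verts W

    threeVertices : (W : WalkIn G (C ≢_) p s) → 3 ≤ suc (length (verts W))
    threeVertices (here _) = ⊥-elim (p≢s refl)
    threeVertices (step _ _ _) = s≤s (s≤s (s≤s z≤n))

    adjacent : ∀ i j → CycNext (length L) i j → Adj G (lookup L i) (lookup L j)
    adjacent zero (suc zero) (inj₁ _) = Cp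
    adjacent (suc i) (suc j) (inj₁ e) = lookup-next W i j (cong pred e)
    adjacent (suc i) zero (inj₂ (e , _)) =
      subst (λ z → Adj G z C) (sym (lookup-last W i (cong pred e))) sC
    adjacent zero zero (inj₁ ())
    adjacent zero (suc (suc _)) (inj₁ ())
    adjacent (suc _) zero (inj₁ ())
    adjacent zero zero (inj₂ (() , _))
    adjacent _ (suc _) (inj₂ (_ , ()))

    cycle : Cycle G (length L)
    cycle = record
      { vtx = lookup L
      ; vtx-inj = λ {i} {j} → lookup-injective L (vertsIn W ∷ pW) i j
      ; vtx-adj = adjacent
      }

  pathVertexUnavoidable : Acyclic G → ∀ {S C x y} (P : WalkIn G S x y) → IsPath P →
                          C ∈L verts P → ¬ WalkIn G (C ≢_) x y
  pathVertexUnavoidable _ _ _ (here refl) Z = startIn Z refl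
  pathVertexUnavoidable acyc {C = C} (step {y = x'} _ a rest) (_ ∷ p) (there C∈rest) Z
    with C ≟ x'
  ... | no C≢x' = pathVertexUnavoidable acyc rest p C∈rest (step C≢x' (Adj-sym G a) Z)
  pathVertexUnavoidable acyc (step _ _ (here _)) _ _ Z | yes refl = endIn Z refl
  pathVertexUnavoidable acyc (step _ a (step _ a' rest)) ((_ ∷ x∉rest) ∷ (C∉rest ∷ _)) _ Z
    | yes refl =
    noCycleThrough acyc (λ e → All.head x∉rest (sym e)) a' a
      (restrict rest C∉rest ++W reverse Z)

-- Fuel bookkeeping for greedy growth of a set of size s inside a universe of
-- size n: growing the set uses up one unit of fuel, and with no fuel left the
-- set cannot grow.
fuel-step : ∀ {n s s'} k → s < s' → n ≤ s + suc k → n ≤ s' + k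
fuel-step {n} {s} {s'} k s<s' bound = begin
  n            ≤⟨ bound ⟩
  s + suc k    ≡⟨ +-suc s k ⟩
  suc s + k    ≤⟨ +-monoˡ-≤ k s<s' ⟩
  s' + k       ∎
  where open ≤-Reasoning

fuel-empty : ∀ {n s s'} → s < s' → s' ≤ n → n ≤ s + 0 → ⊥
fuel-empty {s = s} s<s' s'≤n bound =
  <-irrefl refl (<-≤-trans (≤-<-trans (subst (_ ≤_) (+-identityʳ s) bound) s<s') s'≤n)

module CliqueFacts {n : ℕ} (G : Graph n) where

  cliqueAdd : ∀ {S x} → IsClique G S → (∀ y → y ∈ S → y ≢ x → Adj G y x) →
              IsClique G (S ∪ ⁅ x ⁆)
  cliqueAdd {S} {x} cS ax y z y∈ z∈ y≢z with x∈p∪q⁻ S ⁅ x ⁆ y∈ | x∈p∪q⁻ S ⁅ x ⁆ z∈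
  ... | inj₁ yS | inj₁ zS = cS y z yS zS y≢z
  ... | inj₁ yS | inj₂ zx rewrite x∈⁅y⁆⇒x≡y x zx = ax y yS y≢z
  ... | inj₂ yx | inj₁ zS rewrite x∈⁅y⁆⇒x≡y x yx = Adj-sym G (ax z zS (λ e → y≢z (sym e)))
  ... | inj₂ yx | inj₂ zx rewrite x∈⁅y⁆⇒x≡y x yx | x∈⁅y⁆⇒x≡y x zx = ⊥-elim (y≢z refl)

  ⊆-add : ∀ {S : Subset n} {x} → S ⊆ S ∪ ⁅ x ⁆
  ⊆-add {x = x} = p⊆p∪q ⁅ x ⁆

  ∈-add : ∀ {S : Subset n} {x} → x ∈ S ∪ ⁅ x ⁆
  ∈-add {S} {x} = q⊆p∪q S ⁅ x ⁆ (x∈⁅x⁆ x)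

  add-grows : ∀ {S : Subset n} {x} → x ∉ S → ∣ S ∣ < ∣ S ∪ ⁅ x ⁆ ∣
  add-grows {S} {x} x∉S = p⊂q⇒∣p∣<∣q∣ (⊆-add , x , ∈-add {S} , x∉S)

  Extends : Subset n → Fin n → Set
  Extends S x = x ∉ S × (∀ y → y ∈ S → Adj G y x)

  extends? : ∀ S x → Dec (Extends S x)
  extends? S x = ¬? (x ∈? S) ×-dec all? (λ y → (y ∈? S) →-dec Adj? G y x)

  unextendable⇒max : ∀ {S} → IsClique G S → ¬ ∃ (Extends S) → IsMaxClique G S
  unextendable⇒max {S} cS none = cS , maximal
    where
    maximal : ∀ S' → IsClique G S' → S ⊆ S' → S' ⊆ S
    maximal S' cS' S⊆S' {x} x∈S' with x ∈? S
    ... | yes x∈S = x∈S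
    ... | no x∉S = ⊥-elim (none (x , x∉S , λ y y∈S →
            cS' y x (S⊆S' y∈S) x∈S' (λ e → x∉S (subst (_∈ S) e y∈S))))

  -- Every clique is contained in a maximal clique (greedy extension, with
  -- fuel k bounding the number of vertices still to be added).
  extendToMax : ∀ k S → IsClique G S → n ≤ ∣ S ∣ + k →
                Σ (Subset n) (λ S' → IsMaxClique G S' × S ⊆ S')
  extendToMax k S cS bound with any? (extends? S)
  ... | no none = S , unextendable⇒max cS none , (λ p → p)
  ... | yes (x , x∉S , ax) = grow k bound
    where
    grow : ∀ k → n ≤ ∣ S ∣ + k → Σ (Subset n) (λ S' → IsMaxClique G S' × S ⊆ S')
    grow zero b = ⊥-elim (fuel-empty (add-grows x∉S) (∣p∣≤n (S ∪ ⁅ x ⁆)) b)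
    grow (suc k') b with extendToMax k' (S ∪ ⁅ x ⁆) (cliqueAdd cS (λ y y∈S _ → ax y y∈S))
                           (fuel-step k' (add-grows x∉S) b)
    ... | R , maxR , S'⊆R = R , maxR , (λ p → S'⊆R (⊆-add p))

  nonNeighbour : ∀ {S w} → IsMaxClique G S → w ∉ S → Σ (Fin n) (λ a → a ∈ S × ¬ Adj G a w)
  nonNeighbour {S} {w} (cS , maxS) w∉S with all? (λ a → (a ∈? S) →-dec Adj? G a w)
  ... | yes allAdj = ⊥-elim (w∉S (maxS (S ∪ ⁅ w ⁆)
                      (cliqueAdd cS (λ y y∈S _ → allAdj y y∈S)) ⊆-add (∈-add {S})))
  ... | no notAll with ¬∀⟶∃¬ n _ (λ a → (a ∈? S) →-dec Adj? G a w) notAll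
  ...   | a , ¬a→aw with a ∈? S
  ...     | yes a∈S = a , a∈S , (λ aw → ¬a→aw (λ _ → aw))
  ...     | no a∉S = ⊥-elim (¬a→aw (λ a∈S → ⊥-elim (a∉S a∈S)))

  edgeInMaxClique : ∀ {a b} → Adj G a b → Σ (Subset n) (λ D → IsMaxClique G D × a ∈ D × b ∈ D)
  edgeInMaxClique {a} {b} ab with extendToMax n (⁅ a ⁆ ∪ ⁅ b ⁆) edgeClique (m≤n+m n _)
    where
    singleton : IsClique G ⁅ a ⁆
    singleton y z y∈ z∈ y≢z rewrite x∈⁅y⁆⇒x≡y a y∈ | x∈⁅y⁆⇒x≡y a z∈ = ⊥-elim (y≢z refl)
    edgeClique : IsClique G (⁅ a ⁆ ∪ ⁅ b ⁆)
    edgeClique = cliqueAdd singleton (λ y y∈ _ → subst (λ z → Adj G z b) (sym (x∈⁅y⁆⇒x≡y a y∈)) ab)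
  ... | D , maxD , ab⊆D = D , maxD , ab⊆D (⊆-add (x∈⁅x⁆ a)) , ab⊆D (∈-add {⁅ a ⁆})

module AvoidingWalks {n : ℕ} {G : Graph n} (CT : CliqueTree G) where

  open WalkFacts (T CT) using (_++W_; weaken)
  open CliqueFacts G using (nonNeighbour; edgeInMaxClique)

  Lacks : Fin n → Fin (m CT) → Set
  Lacks w i = w ∉ K CT i

  clique : ∀ i → IsClique G (K CT i)
  clique i = proj₁ (K-max CT i)

  member≢ : ∀ {c w i} → c ∈ K CT i → w ∉ K CT i → c ≢ w
  member≢ ci wi refl = wi ci

  neighbour≢nonNeighbour : ∀ {v a w} → Adj G v w → ¬ Adj G a w → v ≢ a
  neighbour≢nonNeighbour vw ¬aw refl = ¬aw vw

  walkAvoiding : ∀ {c w i j} → c ≢ w → ¬ Adj G c w → c ∈ K CT i → c ∈ K CT j →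
                 WalkIn (T CT) (Lacks w) i j
  walkAvoiding c≢w ¬cw ci cj =
    weaken (λ ck wk → ¬cw (clique _ _ _ ck wk c≢w)) (T-conn CT _ _ _ ci cj)

  avoidingWalk : ClawFree G → ∀ {v w x y} → Adj G v w → v ∈ K CT x → v ∈ K CT y →
                 w ∉ K CT x → w ∉ K CT y → WalkIn (T CT) (Lacks w) x y
  avoidingWalk claw-free {v} {w} {x} {y} vw vx vy wx wy
    with nonNeighbour (K-max CT x) wx | nonNeighbour (K-max CT y) wy
  ... | a , ax , ¬aw | b , by , ¬bw with a ≟ b
  ...   | yes refl = walkAvoiding (member≢ ax wx) ¬aw ax by
  ...   | no a≢b with Adj? G a b
  ...     | no ¬ab = ⊥-elim (claw-free v a b w
                (clique x v a vx ax (neighbour≢nonNeighbour vw ¬aw))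
                (clique y v b vy by (neighbour≢nonNeighbour vw ¬bw))
                vw a≢b (member≢ ax wx) (member≢ by wy) ¬ab ¬aw ¬bw)
  ...     | yes ab with edgeInMaxClique ab
  ...       | D , maxD , aD , bD with K-surj CT D maxD
  ...         | d , refl = walkAvoiding (member≢ ax wx) ¬aw ax aD
                        ++W walkAvoiding (member≢ by wy) ¬bw bD by

open WalkFacts using (toPath; verts; vertsIn; restrict; weaken; pathVertexUnavoidable)
open AvoidingWalks using (clique; avoidingWalk)

corollary3p3 : {n : ℕ} (G : Graph n) → Chordal G → ClawFree G →
    (CT : CliqueTree G) → (v w : Fin n) → v ≢ w →
    InducedConnected (T CT) (λ i → (v ∈ K CT i) × (w ∉ K CT i))
corollary3p3 G _ claw-free CT v w v≢w x y (vx , wx) (vy , wy) with Adj? G v w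
... | no ¬vw = weaken (T CT) (λ vi → vi , λ wi → ¬vw (clique CT _ v w vi wi v≢w))
                 (T-conn CT v x y vx vy)
... | yes vw = restrict (T CT) P (All.zip (vertsIn (T CT) P , All.tabulate onPathLacksW))
  where
  pathInMv = toPath (T CT) (T-conn CT v x y vx vy)
  P = proj₁ pathInMv
  -- Every node on the path P in T[M_v] lies outside M_w: an x–y walk avoids
  -- M_w by step (1), hence avoids every node containing w.
  onPathLacksW : ∀ {i} → i ∈L verts (T CT) P → w ∉ K CT i
  onPathLacksW i∈P wi =
    pathVertexUnavoidable (T CT) (proj₂ (T-tree CT)) P (proj₂ pathInMv) i∈P
      (weaken (T CT) (λ wj i≡j → wj (subst (λ k → w ∈ K CT k) i≡j wi))
        (avoidingWalk CT claw-free vw vx vy wx wy))
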